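{- Let $n,m,d$ be positive integers with $m < n$, $d \mid n$ and $d \ge m \ge 2$. Then $P(n,m,d) = (n/d)^m$.
   Context: The Chebyshev distance between two integer sequences $\sigma,\pi$ of the same length is $\max_i|\sigma(i)-\pi(i)|$ over positions $i$. For positive integers $N$ and $m<N$, $P(N,m,d)$ is the maximum cardinality of a set $A$ of length-$m$ sequences of pairwise distinct symbols from $\{1,\dots,N\}$ such that any two distinct members of $A$ have Chebyshev distance at least $d$. -}

module Defs where

open import Data.Nat using (ℕ; zero; suc; _≤_; _⊔_; ∣_-_∣)
open import Data.Fin using (Fin; toℕ)
open import Data.Vec using (Vec; []; _∷_; lookup)
open import Data.List using (List; length)
open import Data.List.Relation.Unary.All using (All)
open import Data.List.Relation.Unary.AllPairs using (AllPairs)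
open import Data.Product using (_×_; Σ)
open import Relation.Binary.PropositionalEquality using (_≡_; _≢_)

-- Symbols {1,…,N} are represented by Fin N (values 0,…,N-1); the shift by 1
-- does not affect Chebyshev distances.

Distinct : ∀ {N m} → Vec (Fin N) m → Set
Distinct {N} {m} σ = ∀ (i j : Fin m) → lookup σ i ≡ lookup σ j → i ≡ j

cheb : ∀ {N m} → Vec (Fin N) m → Vec (Fin N) m → ℕ
cheb [] [] = 0
cheb (a ∷ σ) (b ∷ π) = ∣ toℕ a - toℕ b ∣ ⊔ cheb σ π

IsCode : (N m d : ℕ) → List (Vec (Fin N) m) → Set
IsCode N m d A =
  All Distinct A × AllPairs _≢_ A × AllPairs (λ σ π → d ≤ cheb σ π) A

P≡ : (N m d k : ℕ) → Set
P≡ N m d k =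
  Σ (List (Vec (Fin N) m)) (λ A → IsCode N m d A × length A ≡ k)
  × (∀ (A : List (Vec (Fin N) m)) → IsCode N m d A → length A ≤ k)

{-# OPTIONS --safe #-}
module Submission where

open import Defs
open import Data.Nat using (ℕ; _<_; _≤_; _^_)
open import Data.Nat.Divisibility using (_∣_; quotient; divides)

open import Data.Nat using (zero; suc; _+_; _*_; _⊔_; ∣_-_∣; z≤n; s≤s)
open import Data.Nat.Properties
open import Data.Fin as F using (Fin; toℕ; inject≤; combine; remainder; funToFin; finToFun)
import Data.Fin.Properties as FP
open import Data.Vec as V using (Vec; []; _∷_; tabulate)
import Data.Vec.Properties as VP
open import Data.List as L using (List; length; allFin)
import Data.List.Properties as LP
open import Data.List.Relation.Unary.All as All using (All)
import Data.List.Relation.Unary.All.Properties as AllP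
open import Data.List.Membership.Propositional.Properties using (∈-lookup)
open import Data.List.Relation.Unary.AllPairs as AP using (AllPairs)
import Data.List.Relation.Unary.AllPairs.Properties as APP
open import Data.List.Relation.Unary.Unique.Propositional.Properties using (allFin⁺)
open import Data.Product using (_,_; ∃)
open import Relation.Binary.PropositionalEquality
open import Relation.Nullary using (yes; no; contradiction)
open import Function using (_∘_)

-- Split the alphabet {0,…,qd−1} into q blocks of d consecutive symbols.
-- Two sequences whose symbols lie in the same block at every position are at
-- Chebyshev distance < d, so a code has at most one member per block pattern,
-- i.e. at most q^m members. Conversely, for each pattern w ∈ [q]^m take the
-- symbol with offset i in block w(i) at position i: the offsets are distinct
-- because m ≤ d, and two different patterns differ in some position by a
-- nonzero multiple of d, giving the q^m sequences of a code.

lookup-dist≤cheb : ∀ {N m} (σ π : Vec (Fin N) m) (p : Fin m) →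
  ∣ toℕ (V.lookup σ p) - toℕ (V.lookup π p) ∣ ≤ cheb σ π
lookup-dist≤cheb (a ∷ σ) (b ∷ π) F.zero    = m≤m⊔n _ _
lookup-dist≤cheb (a ∷ σ) (b ∷ π) (F.suc p) = ≤-trans (lookup-dist≤cheb σ π p) (m≤n⊔m _ _)

cheb-<-pointwise : ∀ {N m d} (σ π : Vec (Fin N) m) → 0 < d →
  (∀ p → ∣ toℕ (V.lookup σ p) - toℕ (V.lookup π p) ∣ < d) → cheb σ π < d
cheb-<-pointwise []      []      0<d _ = 0<d
cheb-<-pointwise (a ∷ σ) (b ∷ π) 0<d close =
  ⊔-lub (close F.zero) (cheb-<-pointwise σ π 0<d (close ∘ F.suc))

cheb-refl : ∀ {N m} (σ : Vec (Fin N) m) → cheb σ σ ≡ 0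
cheb-refl []      = refl
cheb-refl (a ∷ σ) = cong₂ _⊔_ (∣n-n∣≡0 (toℕ a)) (cheb-refl σ)

separated⇒≢ : ∀ {N m d} {σ π : Vec (Fin N) m} → 0 < d → d ≤ cheb σ π → σ ≢ π
separated⇒≢ {σ = σ} 0<d d≤cheb refl = <⇒≱ 0<d (subst (_ ≤_) (cheb-refl σ) d≤cheb)

AllPairs-lookup : ∀ {A : Set} {R : A → A → Set} {xs : List A} → AllPairs R xs →
  ∀ {i j : Fin (length xs)} → i F.< j → R (L.lookup xs i) (L.lookup xs j)
AllPairs-lookup {xs = _ L.∷ xs} (px AP.∷ _) {F.zero} {F.suc j} _ = All.lookup px (∈-lookup {xs = xs} j)
AllPairs-lookup (_ AP.∷ pxs) {F.suc i} {F.suc j} (s≤s i<j) = AllPairs-lookup pxs i<j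

finToFun-injective : ∀ {m q} {k k′ : Fin (q ^ m)} →
  (∀ p → finToFun {q} {m} k p ≡ finToFun k′ p) → k ≡ k′
finToFun-injective {m} {q} {k} {k′} eq = begin
  k                                 ≡⟨ FP.funToFin-finToFin {m} {q} k ⟨
  funToFin (finToFun {q} {m} k)     ≡⟨ funToFin-cong eq ⟩
  funToFin (finToFun {q} {m} k′)    ≡⟨ FP.funToFin-finToFin {m} {q} k′ ⟩
  k′                                ∎
  where
  open ≡-Reasoning
  funToFin-cong : ∀ {m} {f g : Fin m → Fin q} → (∀ p → f p ≡ g p) → funToFin f ≡ funToFin g
  funToFin-cong {zero}  _  = refl
  funToFin-cong {suc m} eq = cong₂ combine (eq F.zero) (funToFin-cong (eq ∘ F.suc))

finToFun-≢ : ∀ {m q} {k k′ : Fin (q ^ m)} → k ≢ k′ →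
  ∃ λ p → finToFun {q} {m} k p ≢ finToFun k′ p
finToFun-≢ {m} {q} {k} {k′} k≢k′ = FP.¬∀⟶∃¬ m _ agreesAt? (k≢k′ ∘ finToFun-injective {m} {q})
  where
  agreesAt? = λ p → finToFun {q} {m} k p FP.≟ finToFun k′ p

module Blocks (q d : ℕ) where

  dist-combine-sameBlock : ∀ (x : Fin q) (i j : Fin d) →
    ∣ toℕ (combine x i) - toℕ (combine x j) ∣ < d
  dist-combine-sameBlock x i j = begin-strict
    ∣ toℕ (combine x i) - toℕ (combine x j) ∣ ≡⟨ cong₂ ∣_-_∣ (FP.toℕ-combine x i) (FP.toℕ-combine x j) ⟩
    ∣ d * toℕ x + toℕ i - d * toℕ x + toℕ j ∣ ≡⟨ ∣m+n-m+o∣≡∣n-o∣ (d * toℕ x) (toℕ i) (toℕ j) ⟩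
    ∣ toℕ i - toℕ j ∣                         ≤⟨ ∣m-n∣≤m⊔n (toℕ i) (toℕ j) ⟩
    toℕ i ⊔ toℕ j                             <⟨ ⊔-lub (FP.toℕ<n i) (FP.toℕ<n j) ⟩
    d                                         ∎
    where open ≤-Reasoning

  dist-combine-sameOffset : ∀ {x y : Fin q} (i : Fin d) → x ≢ y →
    d ≤ ∣ toℕ (combine x i) - toℕ (combine y i) ∣
  dist-combine-sameOffset {x} {y} i x≢y = begin
    d                                         ≡⟨ *-identityʳ d ⟨
    d * 1                                     ≤⟨ *-monoʳ-≤ d (n≢0⇒n>0 (x≢y ∘ FP.toℕ-injective ∘ ∣m-n∣≡0⇒m≡n)) ⟩
    d * ∣ toℕ x - toℕ y ∣                     ≡⟨ *-distribˡ-∣-∣ d (toℕ x) (toℕ y) ⟩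
    ∣ d * toℕ x - d * toℕ y ∣                 ≡⟨ ∣m+n-m+o∣≡∣n-o∣ (toℕ i) (d * toℕ x) (d * toℕ y) ⟨
    ∣ toℕ i + d * toℕ x - toℕ i + d * toℕ y ∣ ≡⟨ cong₂ ∣_-_∣ (+-comm (toℕ i) _) (+-comm (toℕ i) _) ⟩
    ∣ d * toℕ x + toℕ i - d * toℕ y + toℕ i ∣ ≡⟨ cong₂ ∣_-_∣ (FP.toℕ-combine x i) (FP.toℕ-combine y i) ⟨
    ∣ toℕ (combine x i) - toℕ (combine y i) ∣ ∎
    where open ≤-Reasoning

  block : Fin (q * d) → Fin q
  block = F.quotient d

  offset : Fin (q * d) → Fin d
  offset = remainder {q} d

  sameBlock⇒dist< : ∀ (a b : Fin (q * d)) → block a ≡ block b → ∣ toℕ a - toℕ b ∣ < d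
  sameBlock⇒dist< a b eq = begin-strict
    ∣ toℕ a - toℕ b ∣
      ≡⟨ cong₂ (λ a b → ∣ toℕ a - toℕ b ∣) (FP.combine-remQuot {q} d a) (FP.combine-remQuot {q} d b) ⟨
    ∣ toℕ (combine (block a) (offset a)) - toℕ (combine (block b) (offset b)) ∣
      ≡⟨ cong (λ x → ∣ toℕ (combine x (offset a)) - toℕ (combine (block b) (offset b)) ∣) eq ⟩
    ∣ toℕ (combine (block b) (offset a)) - toℕ (combine (block b) (offset b)) ∣
      <⟨ dist-combine-sameBlock (block b) (offset a) (offset b) ⟩
    d ∎
    where open ≤-Reasoning

  blockPattern : ∀ {m} → Vec (Fin (q * d)) m → Fin (q ^ m)
  blockPattern σ = funToFin (λ p → block (V.lookup σ p))

  sameBlockPattern⇒cheb< : ∀ {m} (σ π : Vec (Fin (q * d)) m) → 0 < d →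
    blockPattern σ ≡ blockPattern π → cheb σ π < d
  sameBlockPattern⇒cheb< {m} σ π 0<d eq = cheb-<-pointwise σ π 0<d λ p →
    sameBlock⇒dist< (V.lookup σ p) (V.lookup π p) (begin
      block (V.lookup σ p)                 ≡⟨ FP.finToFun-funToFin (λ p → block (V.lookup σ p)) p ⟨
      finToFun {q} {m} (blockPattern σ) p  ≡⟨ cong (λ k → finToFun k p) eq ⟩
      finToFun {q} {m} (blockPattern π) p  ≡⟨ FP.finToFun-funToFin (λ p → block (V.lookup π p)) p ⟩
      block (V.lookup π p)                 ∎)
    where open ≡-Reasoning

  separated-length≤ : ∀ {m} (A : List (Vec (Fin (q * d)) m)) → 0 < d →
    AllPairs (λ σ π → d ≤ cheb σ π) A → length A ≤ q ^ m
  separated-length≤ {m} A 0<d separated with length A ≤? q ^ m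
  ... | yes fits = fits
  ... | no tooLong with FP.pigeonhole (≰⇒> tooLong) (blockPattern ∘ L.lookup A)
  ... | i , j , i<j , eq = contradiction
        (sameBlockPattern⇒cheb< (L.lookup A i) (L.lookup A j) 0<d eq)
        (≤⇒≯ (AllPairs-lookup separated i<j))

  module Construction {m : ℕ} (m≤d : m ≤ d) where

    encode : Fin (q ^ m) → Vec (Fin (q * d)) m
    encode k = tabulate (λ p → combine (finToFun {q} {m} k p) (inject≤ p m≤d))

    lookup-encode : ∀ k p → V.lookup (encode k) p ≡ combine (finToFun {q} {m} k p) (inject≤ p m≤d)
    lookup-encode k = VP.lookup∘tabulate _

    encode-distinct : ∀ k → Distinct (encode k)
    encode-distinct k i j eq = FP.inject≤-injective m≤d m≤d i j
      (FP.combine-injectiveʳ (finToFun {q} {m} k i) _ (finToFun k j) _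
        (trans (sym (lookup-encode k i)) (trans eq (lookup-encode k j))))

    encode-separated : ∀ {k k′} → k ≢ k′ → d ≤ cheb (encode k) (encode k′)
    encode-separated {k} {k′} k≢k′ with p , differ ← finToFun-≢ {m} {q} k≢k′ = begin
      d
        ≤⟨ dist-combine-sameOffset (inject≤ p m≤d) differ ⟩
      ∣ toℕ (combine (finToFun {q} {m} k p) (inject≤ p m≤d)) - toℕ (combine (finToFun k′ p) (inject≤ p m≤d)) ∣
        ≡⟨ cong₂ (λ a b → ∣ toℕ a - toℕ b ∣) (lookup-encode k p) (lookup-encode k′ p) ⟨
      ∣ toℕ (V.lookup (encode k) p) - toℕ (V.lookup (encode k′) p) ∣
        ≤⟨ lookup-dist≤cheb (encode k) (encode k′) p ⟩
      cheb (encode k) (encode k′)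
        ∎
      where open ≤-Reasoning

    blockCode : List (Vec (Fin (q * d)) m)
    blockCode = L.map encode (allFin (q ^ m))

    blockCode-separated : AllPairs (λ σ π → d ≤ cheb σ π) blockCode
    blockCode-separated = APP.map⁺ (AP.map encode-separated (allFin⁺ (q ^ m)))

    blockCode-isCode : 0 < d → IsCode (q * d) m d blockCode
    blockCode-isCode 0<d =
        AllP.map⁺ (All.universal encode-distinct (allFin (q ^ m)))
      , AP.map (separated⇒≢ 0<d) blockCode-separated
      , blockCode-separated

    blockCode-length : length blockCode ≡ q ^ m
    blockCode-length = trans (LP.length-map encode (allFin (q ^ m))) (LP.length-tabulate _)

theorem19 : (n m d : ℕ) → 1 ≤ n → 2 ≤ m → m < n → m ≤ d →
    (d∣n : d ∣ n) → P≡ n m d (quotient d∣n ^ m)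
-- Only m ≤ d and d > 0 matter; 2 ≤ m is used just to rule out d = 0.
theorem19 .(q * d) m d _ 2≤m _ m≤d (divides q refl) =
    (blockCode , blockCode-isCode 0<d , blockCode-length)
  , λ A (_ , _ , separated) → separated-length≤ A 0<d separated
  where
  open Blocks q d
  open Construction m≤d
  0<d : 0 < d
  0<d = ≤-trans (≤-trans (s≤s z≤n) 2≤m) m≤d
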